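{- Let $Q,R,S\in\mathfrak{P}$ and let $\rho$ be a strong I-scheme from $Q\times R$ to $Q\times S$ such that (a) for all $P\in\mathfrak{P}_r$, $\xi,\zeta\in\mathcal{H}(P,Q)$, $\theta\in\mathcal{H}(P,R)$: $\xi\ne\zeta$ implies $\rho_P(\xi,\theta)_1\ne\rho_P(\zeta,\theta)_1$; and (b) for all $P\in\mathfrak{P}_r$ and $\xi\in\mathcal{H}(P,Q\times R)$: if $\xi_1\in\mathcal{C}(P)$ then $\rho_P(\xi)_1\in\mathcal{C}(P)$. Fix $q\in Q$; for $P\in\mathfrak{P}_r$, $\xi\in\mathcal{H}(P,R)$ let $\phi_P^0(\xi):=c_{P,q}$, $\phi_P^i(\xi):=\rho_P(\phi_P^{i-1}(\xi),\xi)_1$ ($i\in\mathbb{N}$), $\Phi_P^i(\xi):=(\phi_P^i(\xi),\xi)$, let $n_P(\xi)\in\mathbb{N}$ satisfy $\phi_P^{n_P(\xi)}(\xi)=c_{P,q}$ (such integers exist), and let $\tau_P(\xi):=\rho_P(\Phi_P^{n_P(\xi)-1}(\xi))_2$. Then $R\sqsubseteq_I S$, and $\tau=(\tau_P)_{P\in\mathfrak{P}_r}$ is a strong I-scheme from $R$ to $S$.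
   Context: $\mathfrak{P}$ is the class of finite nonempty posets and $\mathfrak{P}_r$ a fixed system of representatives of its isomorphism classes; $\mathbb{N}=\{1,2,\dots\}$. $\mathcal{H}(P,Q)$ is the set of order-preserving maps $P\to Q$; $Q\times R$ is the product poset. For $\xi\in\mathcal{H}(P,Q)$, $\theta\in\mathcal{H}(P,R)$, $(\xi,\theta)$ is $x\mapsto(\xi(x),\theta(x))$; for a map $\mu$ into a product, $\mu_1,\mu_2$ denote its components. $c_{P,q}$ is the constant map $P\to Q$ with value $q$, and $\mathcal{C}(P)=\{c_{P,q}:q\in Q\}$. For $A\subseteq P$, $x\in A$: $\gamma_A(x)$ is the set of $y\in A$ joined to $x$ by a sequence $x=z_0,\dots,z_L=y$ in $A$ ($L\ge0$) with consecutive elements strictly comparable; for a map $\xi$ on $P$, $G_\xi(x):=\gamma_{\xi^{ -1}(\xi(x))}(x)$. For $A\subseteq P$, ${\downarrow^{\circ}}A:=\{y: y\le a\text{ for some }a\in A\}\setminus A$, ${\uparrow_{\circ}}A:=\{y: y\ge a\text{ for some }a\in A\}\setminus A$. The EV-system $\mathcal{E}(P)$ is the set of triples $(x,D,U)$ with $x\in P$, $D\subseteq{\downarrow^{\circ}}\{x\}$, $U\subseteq{\uparrow_{\circ}}\{x\}$; $\mathfrak a<_+\mathfrak b$ iff $\mathfrak a_1\in\mathfrak b_2$ and $\mathfrak b_1\in\mathfrak a_3$; $\le_+$ is $<_+$ plus equality. For $\xi\in\mathcal{H}(P,Q)$, $\alpha_{P,\xi}(x):=(\xi(x),\xi({\downarrow^{\circ}}G_\xi(x)),\xi({\uparrow_{\circ}}G_\xi(x)))$.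 A Hom-scheme from $A$ to $B$ is a family $(\rho_P)_{P\in\mathfrak{P}_r}$ of maps $\rho_P:\mathcal{H}(P,A)\to\mathcal{H}(P,B)$; strong if each $\rho_P$ is injective; an I-scheme if for all $P,P'\in\mathfrak{P}_r$, $\xi\in\mathcal{H}(P,A)$, $\zeta\in\mathcal{H}(P',A)$, $x\in P$, $y\in P'$: $\alpha_{P,\xi}(x)\le_+\alpha_{P',\zeta}(y)$ implies $\alpha_{P,\rho_P(\xi)}(x)\le_+\alpha_{P',\rho_{P'}(\zeta)}(y)$, with $<_+$ preserved. $R\sqsubseteq_I S$ means a strong I-scheme from $R$ to $S$ exists. -}

module Defs where

open import Level using (Level)
open import Data.Nat using (ℕ; zero; suc; _∸_)
open import Data.Fin using (Fin)
open import Data.Product using (Σ; ∃; ∃-syntax; _×_; _,_; proj₁; proj₂)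
open import Data.Sum using (_⊎_)
open import Relation.Nullary using (¬_)
open import Relation.Binary.PropositionalEquality using (_≡_; _≢_; refl; sym; trans; cong₂; isEquivalence)
open import Relation.Binary.Structures using (IsPartialOrder; IsPreorder)
open import Function.Bundles using (_↔_; _⇔_)

record Pos : Set₁ where
  field
    Carrier : Set
    _≤_     : Carrier → Carrier → Set
    isPO    : IsPartialOrder _≡_ _≤_

  _<_ : Carrier → Carrier → Set
  x < y = (x ≤ y) × (x ≢ y)

  refl≤ : ∀ {x} → x ≤ x
  refl≤ = IsPartialOrder.refl isPO

open Pos public using (Carrier)

-- finite nonempty posets (the class 𝔓)
record FinPoset : Set₁ where
  field
    pos  : Pos
    size : ℕ
    enum : Carrier pos ↔ Fin (suc size)

open FinPoset public using (pos)

_⊗_ : Pos → Pos → Pos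
A ⊗ B = record
  { Carrier = Carrier A × Carrier B
  ; _≤_ = λ u v → Pos._≤_ A (proj₁ u) (proj₁ v) × Pos._≤_ B (proj₂ u) (proj₂ v)
  ; isPO = record
    { isPreorder = record
      { isEquivalence = isEquivalence
      ; reflexive = λ { refl → Pos.refl≤ A , Pos.refl≤ B }
      ; trans = λ p q → IsPartialOrder.trans (Pos.isPO A) (proj₁ p) (proj₁ q)
                      , IsPartialOrder.trans (Pos.isPO B) (proj₂ p) (proj₂ q)
      }
    ; antisym = λ p q → cong₂ _,_ (IsPartialOrder.antisym (Pos.isPO A) (proj₁ p) (proj₁ q))
                                  (IsPartialOrder.antisym (Pos.isPO B) (proj₂ p) (proj₂ q))
    }
  }

record Iso (P P' : FinPoset) : Set where
  private
    module A = Pos (pos P)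
    module B = Pos (pos P')
  field
    to      : A.Carrier → B.Carrier
    from    : B.Carrier → A.Carrier
    from∘to : ∀ x → from (to x) ≡ x
    to∘from : ∀ y → to (from y) ≡ y
    order   : ∀ x y → (x A.≤ y) ⇔ (to x B.≤ to y)

record RepSystem : Set₂ where
  field
    Index    : Set₁
    rep      : Index → FinPoset
    complete : (P : FinPoset) → ∃[ i ] Iso P (rep i)
    distinct : (i j : Index) → Iso (rep i) (rep j) → i ≡ j

record Hom (P A : Pos) : Set where
  constructor hom
  field
    fun  : Carrier P → Carrier A
    mono : ∀ {x y} → Pos._≤_ P x y → Pos._≤_ A (fun x) (fun y)

open Hom public using (fun; mono)

_≈H_ : ∀ {P A} → Hom P A → Hom P A → Set
_≈H_ {P} ξ ζ = (x : Carrier P) → fun ξ x ≡ fun ζ x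

const : (P : Pos) {A : Pos} → Carrier A → Hom P A
const P {A} a = hom (λ _ → a) (λ _ → Pos.refl≤ A)

IsConst : ∀ {P A} → Hom P A → Set
IsConst {P} {A} ξ = ∃[ a ] (ξ ≈H const P {A} a)

pair : ∀ {P A B} → Hom P A → Hom P B → Hom P (A ⊗ B)
pair ξ θ = hom (λ x → fun ξ x , fun θ x) (λ p → mono ξ p , mono θ p)

comp₁ : ∀ {P A B} → Hom P (A ⊗ B) → Hom P A
comp₁ μ = hom (λ x → proj₁ (fun μ x)) (λ p → proj₁ (mono μ p))

comp₂ : ∀ {P A B} → Hom P (A ⊗ B) → Hom P B
comp₂ μ = hom (λ x → proj₂ (fun μ x)) (λ p → proj₂ (mono μ p))

Subset : Set → Set₁
Subset X = X → Set

-- z₀ = x, ..., z_L = y, all z_k (k ≥ 1) in A, consecutive strictly comparable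
data Conn (P : Pos) (A : Subset (Carrier P)) : Carrier P → Carrier P → Set where
  here : ∀ {x} → Conn P A x x
  step : ∀ {x y z} → A y → (Pos._<_ P x y ⊎ Pos._<_ P y x) → Conn P A y z → Conn P A x z

-- γ_A(x)  (used for x ∈ A)
γ : (P : Pos) → Subset (Carrier P) → Carrier P → Subset (Carrier P)
γ P A x y = Conn P A x y

G : ∀ {P A} → Hom P A → Carrier P → Subset (Carrier P)
G {P} ξ x = γ P (λ z → fun ξ z ≡ fun ξ x) x

down° : (P : Pos) → Subset (Carrier P) → Subset (Carrier P)
down° P A y = (∃[ a ] (A a × Pos._≤_ P y a)) × ¬ A y

up° : (P : Pos) → Subset (Carrier P) → Subset (Carrier P)
up° P A y = (∃[ a ] (A a × Pos._≤_ P a y)) × ¬ A y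

image : ∀ {X Y : Set} → (X → Y) → Subset X → Subset Y
image f A b = ∃[ a ] (A a × f a ≡ b)

record EV (A : Pos) : Set₁ where
  constructor ev
  field
    pt : Carrier A
    D  : Subset (Carrier A)
    U  : Subset (Carrier A)

_≈EV_ : ∀ {A} → EV A → EV A → Set
a ≈EV b = (EV.pt a ≡ EV.pt b)
        × (∀ y → EV.D a y ⇔ EV.D b y)
        × (∀ y → EV.U a y ⇔ EV.U b y)

_<₊_ : ∀ {A} → EV A → EV A → Set
a <₊ b = EV.D b (EV.pt a) × EV.U a (EV.pt b)

_≤₊_ : ∀ {A} → EV A → EV A → Set
a ≤₊ b = (a ≈EV b) ⊎ (a <₊ b)

α : ∀ {P A} → Hom P A → Carrier P → EV A
α {P} ξ x = ev (fun ξ x)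
               (image (fun ξ) (down° P (G ξ x)))
               (image (fun ξ) (up° P (G ξ x)))

module Schemes (𝔯 : RepSystem) where
  open RepSystem 𝔯

  Rp : Index → Pos
  Rp i = pos (rep i)

  Scheme : Pos → Pos → Set₁
  Scheme A B = (i : Index) → Hom (Rp i) A → Hom (Rp i) B

  WellDefined : ∀ {A B} → Scheme A B → Set₁
  WellDefined ρ = ∀ i (ξ ζ : Hom (Rp i) _) → ξ ≈H ζ → ρ i ξ ≈H ρ i ζ

  Injective : ∀ {A B} → Scheme A B → Set₁
  Injective ρ = ∀ i (ξ ζ : Hom (Rp i) _) → ρ i ξ ≈H ρ i ζ → ξ ≈H ζ

  IProperty : ∀ {A B} → Scheme A B → Set₁
  IProperty {A} ρ =
    ∀ i j (ξ : Hom (Rp i) A) (ζ : Hom (Rp j) A) (x : Carrier (Rp i)) (y : Carrier (Rp j)) →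
      (α ξ x ≤₊ α ζ y → α (ρ i ξ) x ≤₊ α (ρ j ζ) y)
    × (α ξ x <₊ α ζ y → α (ρ i ξ) x <₊ α (ρ j ζ) y)

  StrongIScheme : ∀ {A B} → Scheme A B → Set₁
  StrongIScheme ρ = WellDefined ρ × Injective ρ × IProperty ρ

  _⊑I_ : FinPoset → FinPoset → Set₁
  R ⊑I S = Σ (Scheme (pos R) (pos S)) StrongIScheme

  module Construction (Q R S : FinPoset) (ρ : Scheme (pos Q ⊗ pos R) (pos Q ⊗ pos S))
                      (q : Carrier (pos Q)) where

    φ : (i : Index) → ℕ → Hom (Rp i) (pos R) → Hom (Rp i) (pos Q)
    φ i zero    ξ = const (Rp i) q
    φ i (suc k) ξ = comp₁ (ρ i (pair (φ i k ξ) ξ))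

    Φ : (i : Index) → ℕ → Hom (Rp i) (pos R) → Hom (Rp i) (pos Q ⊗ pos R)
    Φ i k ξ = pair (φ i k ξ) ξ

    τ : (n : (i : Index) → Hom (Rp i) (pos R) → ℕ) → Scheme (pos R) (pos S)
    τ n i ξ = comp₂ (ρ i (Φ i (n i ξ ∸ 1) ξ))

-- By (b) every iterate φⁱ(ξ) is constant, and by (a) the step c ↦ ρ(c, ξ)₁ is injective on
-- constants; on the finite Q it is therefore a permutation, so the orbit of q returns to q and
-- φⁿ⁻¹(ξ) is the unique predecessor of q on it.  For a map (c, θ) with constant first
-- component, α is just α of θ tagged with c, so ρ's I-property, applied along the orbit,
-- turns α ξ x ≤₊ α ζ y into equality of the orbits at x and y, hence of their predecessors of
-- q.  At that index ρ therefore compares (φⁿ⁻¹(ξ), ξ) and (φⁿ⁻¹(ζ), ζ) exactly as ξ and ζ, and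
-- the first components of the results are both q, so τ = ρ(Φⁿ⁻¹)₂ inherits every property.
module Submission where

open import Defs
open import Data.Nat using (ℕ; zero; suc; _+_; _∸_; _≤_)
open import Data.Nat.Properties using (n<1+n; m<n⇒0<n∸m; m+[n∸m]≡n; <⇒≤)
import Data.Fin as Fin
open import Data.Fin using (toℕ)
open import Data.Fin.Properties using (pigeonhole; inj⇒≟)
open import Data.Product using (∃-syntax; _×_; _,_; proj₁; proj₂)
open import Data.Sum using (inj₁; inj₂)
open import Data.Sum.Function.Propositional using (_⊎-⇔_)
open import Function.Base using (_∘_)
open import Function.Bundles using (_⇔_; mk⇔; Equivalence; Inverse; Injection)
open import Function.Properties.Inverse using (↔⇒↣)
import Function.Properties.Equivalence as ⇔
open import Relation.Binary.Definitions using (DecidableEquality)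
open import Relation.Nullary using (¬_)
open import Relation.Nullary.Decidable using (decidable-stable)
open import Relation.Binary.PropositionalEquality
  using (_≡_; refl; sym; trans; cong; cong₂; subst)

open Equivalence using (to; from)

_≐_ : {X : Set} → Subset X → Subset X → Set
S ≐ T = ∀ w → S w ⇔ T w

Conn-mono : ∀ {P A B x w} → (∀ z → A z → B z) → Conn P A x w → Conn P B x w
Conn-mono A⊆B here           = here
Conn-mono A⊆B (step a z∼ c) = step (A⊆B _ a) z∼ (Conn-mono A⊆B c)

down°-cong : ∀ P {S T : Subset (Carrier P)} → S ≐ T → down° P S ≐ down° P T
down°-cong P S≐T w =
  mk⇔ (λ ((a , s , w≤a) , w∉S) → (a , to (S≐T a) s , w≤a) , w∉S ∘ from (S≐T w))
      (λ ((a , t , w≤a) , w∉T) → (a , from (S≐T a) t , w≤a) , w∉T ∘ to (S≐T w))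

up°-cong : ∀ P {S T : Subset (Carrier P)} → S ≐ T → up° P S ≐ up° P T
up°-cong P S≐T w =
  mk⇔ (λ ((a , s , a≤w) , w∉S) → (a , to (S≐T a) s , a≤w) , w∉S ∘ from (S≐T w))
      (λ ((a , t , a≤w) , w∉T) → (a , from (S≐T a) t , a≤w) , w∉T ∘ to (S≐T w))

image-cong : ∀ {X Y : Set} (f : X → Y) {S T : Subset X} → S ≐ T → image f S ≐ image f T
image-cong f S≐T b = mk⇔ (λ (a , s , fa≡b) → a , to (S≐T a) s , fa≡b)
                         (λ (a , t , fa≡b) → a , from (S≐T a) t , fa≡b)

module _ {A : Pos} where

  ≈EV-sym : {a b : EV A} → a ≈EV b → b ≈EV a
  ≈EV-sym (p , D≐ , U≐) = sym p , ⇔.sym ∘ D≐ , ⇔.sym ∘ U≐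

  ≈EV-trans : {a b c : EV A} → a ≈EV b → b ≈EV c → a ≈EV c
  ≈EV-trans (p , D≐ , U≐) (p′ , D≐′ , U≐′) =
    trans p p′ , (λ y → ⇔.trans (D≐ y) (D≐′ y)) , (λ y → ⇔.trans (U≐ y) (U≐′ y))

  module _ {a a′ b b′ : EV A} (a≈a′ : a ≈EV a′) (b≈b′ : b ≈EV b′) where

    <₊-resp-≈EV : a <₊ b → a′ <₊ b′
    <₊-resp-≈EV (a∈Db , b∈Ua) =
      let (pa , _ , U≐) = a≈a′
          (pb , D≐ , _) = b≈b′
      in to (D≐ _) (subst (EV.D b) pa a∈Db) , to (U≐ _) (subst (EV.U a) pb b∈Ua)

    ≤₊-resp-≈EV : a ≤₊ b → a′ ≤₊ b′
    ≤₊-resp-≈EV (inj₁ a≈b) = inj₁ (≈EV-trans (≈EV-sym a≈a′) (≈EV-trans a≈b b≈b′))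
    ≤₊-resp-≈EV (inj₂ a<b) = inj₂ (<₊-resp-≈EV a<b)

  module _ {a a′ b b′ : EV A} (a≈a′ : a ≈EV a′) (b≈b′ : b ≈EV b′) where

    <₊-cong-≈EV : (a <₊ b) ⇔ (a′ <₊ b′)
    <₊-cong-≈EV = mk⇔ (<₊-resp-≈EV a≈a′ b≈b′) (<₊-resp-≈EV (≈EV-sym a≈a′) (≈EV-sym b≈b′))

    ≤₊-cong-≈EV : (a ≤₊ b) ⇔ (a′ ≤₊ b′)
    ≤₊-cong-≈EV = mk⇔ (≤₊-resp-≈EV a≈a′ b≈b′) (≤₊-resp-≈EV (≈EV-sym a≈a′) (≈EV-sym b≈b′))

pt-∈-image-of-≤₊α : ∀ {P A} {a : EV A} {ν : Hom P A} {y} → a ≤₊ α ν y → ∃[ z ] EV.pt a ≡ fun ν z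
pt-∈-image-of-≤₊α {y = y} (inj₁ (pa≡νy , _)) = y , pa≡νy
pt-∈-image-of-≤₊α (inj₂ ((z , _ , νz≡pa) , _)) = z , sym νz≡pa

module _ {A B : Pos} (c : Carrier A) where

  lift : EV B → EV (A ⊗ B)
  lift a = ev (c , EV.pt a) (λ u → proj₁ u ≡ c × EV.D a (proj₂ u))
                            (λ u → proj₁ u ≡ c × EV.U a (proj₂ u))

  lift-≈EV⇔ : ∀ {a b} → (lift a ≈EV lift b) ⇔ (a ≈EV b)
  lift-≈EV⇔ = mk⇔
    (λ (p , D≐ , U≐) → cong proj₂ p , untag D≐ , untag U≐)
    (λ (p , D≐ , U≐) → cong (c ,_) p , tag D≐ , tag U≐)
    where
      untag : ∀ {X Y} → (λ u → proj₁ u ≡ c × X (proj₂ u)) ≐ (λ u → proj₁ u ≡ c × Y (proj₂ u))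
            → X ≐ Y
      untag X≐Y y = mk⇔ (λ x → proj₂ (to (X≐Y (c , y)) (refl , x)))
                        (λ x → proj₂ (from (X≐Y (c , y)) (refl , x)))
      tag : ∀ {X Y} → X ≐ Y
          → (λ u → proj₁ u ≡ c × X (proj₂ u)) ≐ (λ u → proj₁ u ≡ c × Y (proj₂ u))
      tag X≐Y (_ , y) = mk⇔ (λ (e , x) → e , to (X≐Y y) x) (λ (e , x) → e , from (X≐Y y) x)

  lift-<₊⇔ : ∀ {a b} → (lift a <₊ lift b) ⇔ (a <₊ b)
  lift-<₊⇔ = mk⇔ (λ (a∈Db , b∈Ua) → proj₂ a∈Db , proj₂ b∈Ua)
                 (λ (a∈Db , b∈Ua) → (refl , a∈Db) , (refl , b∈Ua))

  lift-≤₊⇔ : ∀ {a b} → (lift a ≤₊ lift b) ⇔ (a ≤₊ b)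
  lift-≤₊⇔ {a} {b} = lift-≈EV⇔ ⊎-⇔ lift-<₊⇔ {a} {b}

module _ {P A B : Pos} (μ : Hom P (A ⊗ B)) {c : Carrier A} (μ₁≈c : comp₁ μ ≈H const P c) where

  G-comp₂ : ∀ x → G μ x ≐ G (comp₂ μ) x
  G-comp₂ x w = mk⇔ (Conn-mono λ _ → cong proj₂)
                    (Conn-mono λ z → cong₂ _,_ (trans (μ₁≈c z) (sym (μ₁≈c x))))

  image-comp₂ : ∀ S → image (fun μ) S ≐ (λ b → proj₁ b ≡ c × image (fun (comp₂ μ)) S (proj₂ b))
  image-comp₂ S b =
    mk⇔ (λ (a , s , μa≡b) → trans (sym (cong proj₁ μa≡b)) (μ₁≈c a) , a , s , cong proj₂ μa≡b)
        (λ (b₁≡c , a , s , μ₂a≡b₂) → a , s , cong₂ _,_ (trans (μ₁≈c a) (sym b₁≡c)) μ₂a≡b₂)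

  α-comp₂ : ∀ x → α μ x ≈EV lift c (α (comp₂ μ) x)
  α-comp₂ x = cong (_, _) (μ₁≈c x)
            , (λ b → ⇔.trans (image-cong (fun μ) (down°-cong P (G-comp₂ x)) b) (image-comp₂ _ b))
            , (λ b → ⇔.trans (image-cong (fun μ) (up°-cong P (G-comp₂ x)) b) (image-comp₂ _ b))

module _ {P P′ A B : Pos} (μ : Hom P (A ⊗ B)) (ν : Hom P′ (A ⊗ B)) {c : Carrier A}
         (μ₁≈c : comp₁ μ ≈H const P c) (ν₁≈c : comp₁ ν ≈H const P′ c)
         {x : Carrier P} {y : Carrier P′} where

  α-comp₂-≤₊⇔ : (α μ x ≤₊ α ν y) ⇔ (α (comp₂ μ) x ≤₊ α (comp₂ ν) y)
  α-comp₂-≤₊⇔ = ⇔.trans (≤₊-cong-≈EV {A ⊗ B} (α-comp₂ μ μ₁≈c x) (α-comp₂ ν ν₁≈c y))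
                        (lift-≤₊⇔ {A} {B} c {α (comp₂ μ) x} {α (comp₂ ν) y})

  α-comp₂-<₊⇔ : (α μ x <₊ α ν y) ⇔ (α (comp₂ μ) x <₊ α (comp₂ ν) y)
  α-comp₂-<₊⇔ = ⇔.trans (<₊-cong-≈EV {A ⊗ B} (α-comp₂ μ μ₁≈c x) (α-comp₂ ν ν₁≈c y))
                        (lift-<₊⇔ {A} {B} c {α (comp₂ μ) x} {α (comp₂ ν) y})

≡-dec : (P : FinPoset) → DecidableEquality (Carrier (pos P))
≡-dec P = inj⇒≟ (↔⇒↣ (FinPoset.enum P))

module TheoremNine (𝔯 : RepSystem) (Q R S : FinPoset)
    (ρ : Schemes.Scheme 𝔯 (pos Q ⊗ pos R) (pos Q ⊗ pos S))
    (ρ-strong : Schemes.StrongIScheme 𝔯 ρ)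
    (ρ₁-injective : ∀ i (ξ ζ : Hom (Schemes.Rp 𝔯 i) (pos Q)) (θ : Hom (Schemes.Rp 𝔯 i) (pos R)) →
      ¬ (ξ ≈H ζ) → ¬ (comp₁ (ρ i (pair ξ θ)) ≈H comp₁ (ρ i (pair ζ θ))))
    (ρ₁-const : ∀ i (ξ : Hom (Schemes.Rp 𝔯 i) (pos Q ⊗ pos R)) →
      IsConst (comp₁ ξ) → IsConst (comp₁ (ρ i ξ)))
    (q : Carrier (pos Q)) where

  open RepSystem 𝔯 using (rep)
  open Schemes 𝔯
  open Construction Q R S ρ q

  ρ-wellDefined : WellDefined ρ
  ρ-wellDefined = proj₁ ρ-strong

  ρ-injective : Injective ρ
  ρ-injective = proj₁ (proj₂ ρ-strong)

  ρ-IProperty : IProperty ρ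
  ρ-IProperty = proj₂ (proj₂ ρ-strong)

  φ-constant : ∀ i k ξ z w → fun (φ i k ξ) z ≡ fun (φ i k ξ) w
  φ-constant i zero    ξ z w = refl
  φ-constant i (suc k) ξ z w =
    let (_ , φ′≈c) = ρ₁-const i (Φ i k ξ) (fun (φ i k ξ) z , λ u → φ-constant i k ξ u z)
    in trans (φ′≈c z) (sym (φ′≈c w))

  -- Hypothesis (a) only refutes the inequality; equality on the finite Q is decidable.
  φ-suc-injective : ∀ {i ξ} a b p →
    fun (φ i (suc a) ξ) p ≡ fun (φ i (suc b) ξ) p → fun (φ i a ξ) p ≡ fun (φ i b ξ) p
  φ-suc-injective {i} {ξ} a b p e = decidable-stable (≡-dec Q _ _) λ ne →
    ρ₁-injective i (φ i a ξ) (φ i b ξ) ξ (λ φa≈φb → ne (φa≈φb p))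
      λ z → trans (φ-constant i (suc a) ξ z p) (trans e (φ-constant i (suc b) ξ p z))

  φ-periodic : ∀ {i ξ p} m d → fun (φ i (m + d) ξ) p ≡ fun (φ i m ξ) p → fun (φ i d ξ) p ≡ q
  φ-periodic zero    d e = e
  φ-periodic (suc m) d e = φ-periodic m d (φ-suc-injective (m + d) m _ e)

  -- Pigeonhole on the first |Q| + 1 iterates at some point p₀.
  φ-returns : ∀ i (ξ : Hom (Rp i) (pos R)) → ∃[ n ] (1 ≤ n × φ i n ξ ≈H const (Rp i) q)
  φ-returns i ξ =
    let (a , b , a<b , same) = pigeonhole (n<1+n _) (λ k → Inverse.to E (fun (φ i (toℕ k) ξ) p₀))
        m = toℕ a
        d = toℕ b ∸ m
        φm+d≡φm = subst (λ k → fun (φ i k ξ) p₀ ≡ fun (φ i m ξ) p₀)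
                        (sym (m+[n∸m]≡n (<⇒≤ a<b)))
                        (sym (Injection.injective (↔⇒↣ E) same))
    in d , m<n⇒0<n∸m a<b , λ z → trans (φ-constant i d ξ z p₀) (φ-periodic m d φm+d≡φm)
    where
      E = FinPoset.enum Q
      p₀ = Inverse.from (FinPoset.enum (rep i)) Fin.zero

  φ-cong : ∀ {i ξ ζ} → ξ ≈H ζ → ∀ k → φ i k ξ ≈H φ i k ζ
  φ-cong ξ≈ζ zero    z = refl
  φ-cong ξ≈ζ (suc k) z =
    cong proj₁ (ρ-wellDefined _ _ _ (λ w → cong₂ _,_ (φ-cong ξ≈ζ k w) (ξ≈ζ w)) z)

  ≤₊⇒same-orbit : ∀ {i j ξ ζ x y} → α ξ x ≤₊ α ζ y → ∀ k → fun (φ i k ξ) x ≡ fun (φ j k ζ) y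
  ≤₊⇒same-orbit le zero = refl
  ≤₊⇒same-orbit {i} {j} {ξ} {ζ} {x} {y} le (suc k) =
    let Φ≤ = from (α-comp₂-≤₊⇔ (Φ i k ξ) (Φ j k ζ)
                    (λ z → trans (φ-constant i k ξ z x) (≤₊⇒same-orbit le k))
                    (λ z → φ-constant j k ζ z y)) le
        (z , e) = pt-∈-image-of-≤₊α {ν = ρ j (Φ j k ζ)} (proj₁ (ρ-IProperty i j _ _ x y) Φ≤)
    in trans (cong proj₁ e) (φ-constant j (suc k) ζ z y)

  module _ (n : ∀ i → Hom (Rp i) (pos R) → ℕ)
           (n-returns : ∀ i ξ → 1 ≤ n i ξ × φ i (n i ξ) ξ ≈H const (Rp i) q) where

    last : ∀ i → Hom (Rp i) (pos R) → ℕ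
    last i ξ = n i ξ ∸ 1

    q-after-last : ∀ i ξ → comp₁ (ρ i (Φ i (last i ξ) ξ)) ≈H const (Rp i) q
    q-after-last i ξ = subst (λ k → φ i k ξ ≈H const (Rp i) q)
                             (sym (m+[n∸m]≡n (proj₁ (n-returns i ξ))))
                             (proj₂ (n-returns i ξ))

    last-agree : ∀ {i j ξ ζ x y} → (∀ k → fun (φ i k ξ) x ≡ fun (φ j k ζ) y) →
      fun (φ i (last i ξ) ξ) x ≡ fun (φ j (last j ζ) ζ) y
    last-agree {i} {j} {ξ} {ζ} {x} {y} orbit =
      trans (φ-suc-injective (last i ξ) (last j ζ) x both-q) (orbit (last j ζ))
      where
        both-q : fun (φ i (suc (last i ξ)) ξ) x ≡ fun (φ i (suc (last j ζ)) ξ) x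
        both-q = trans (q-after-last i ξ x)
                       (trans (sym (q-after-last j ζ y)) (sym (orbit (suc (last j ζ)))))

    τ-wellDefined : WellDefined (τ n)
    τ-wellDefined i ξ ζ ξ≈ζ z = cong proj₂ (ρ-wellDefined i _ _
      (λ w → cong₂ _,_ (last-agree (λ k → φ-cong ξ≈ζ k w)) (ξ≈ζ w)) z)

    τ-injective : Injective (τ n)
    τ-injective i ξ ζ τξ≈τζ z = cong proj₂ (ρ-injective i _ _
      (λ w → cong₂ _,_ (trans (q-after-last i ξ w) (sym (q-after-last i ζ w))) (τξ≈τζ w)) z)

    τ-IProperty : IProperty (τ n)
    τ-IProperty i j ξ ζ x y =
        (λ le → to (α-comp₂-≤₊⇔ (ρ i μ) (ρ j ν) (q-after-last i ξ) (q-after-last j ζ))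
                   (proj₁ (ρ-IProperty i j μ ν x y) (from (α-comp₂-≤₊⇔ μ ν (μ₁≈c le) ν₁≈c) le)))
      , (λ lt → to (α-comp₂-<₊⇔ (ρ i μ) (ρ j ν) (q-after-last i ξ) (q-after-last j ζ))
                   (proj₂ (ρ-IProperty i j μ ν x y) (from (α-comp₂-<₊⇔ μ ν (μ₁≈c (inj₂ lt)) ν₁≈c) lt)))
      where
        μ = Φ i (last i ξ) ξ
        ν = Φ j (last j ζ) ζ
        c = fun (φ j (last j ζ) ζ) y
        ν₁≈c : comp₁ ν ≈H const (Rp j) c
        ν₁≈c z = φ-constant j (last j ζ) ζ z y
        μ₁≈c : α ξ x ≤₊ α ζ y → comp₁ μ ≈H const (Rp i) c
        μ₁≈c le z = trans (φ-constant i (last i ξ) ξ z x) (last-agree (≤₊⇒same-orbit le))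

    τ-strong : StrongIScheme (τ n)
    τ-strong = τ-wellDefined , τ-injective , τ-IProperty

theorem9 : (𝔯 : RepSystem) (Q R S : FinPoset)
    (ρ : Schemes.Scheme 𝔯 (pos Q ⊗ pos R) (pos Q ⊗ pos S)) →
    Schemes.StrongIScheme 𝔯 ρ →
    (∀ i (ξ ζ : Hom (Schemes.Rp 𝔯 i) (pos Q)) (θ : Hom (Schemes.Rp 𝔯 i) (pos R)) →
      ¬ (ξ ≈H ζ) → ¬ (comp₁ (ρ i (pair ξ θ)) ≈H comp₁ (ρ i (pair ζ θ)))) →
    (∀ i (ξ : Hom (Schemes.Rp 𝔯 i) (pos Q ⊗ pos R)) →
      IsConst (comp₁ ξ) → IsConst (comp₁ (ρ i ξ))) →
    (q : Carrier (pos Q)) →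
    (∀ i (ξ : Hom (Schemes.Rp 𝔯 i) (pos R)) → ∃[ n ] (1 ≤ n
      × Schemes.Construction.φ 𝔯 Q R S ρ q i n ξ ≈H const (Schemes.Rp 𝔯 i) q))
    × Schemes._⊑I_ 𝔯 R S
    × ((n : ∀ i → Hom (Schemes.Rp 𝔯 i) (pos R) → ℕ) →
       (∀ i ξ → 1 ≤ n i ξ
         × Schemes.Construction.φ 𝔯 Q R S ρ q i (n i ξ) ξ ≈H const (Schemes.Rp 𝔯 i) q) →
       Schemes.StrongIScheme 𝔯 (Schemes.Construction.τ 𝔯 Q R S ρ q n))
theorem9 𝔯 Q R S ρ ρ-strong ρ₁-injective ρ₁-const q =
    φ-returns
  , (τ n₀ , τ-strong n₀ (λ i ξ → proj₂ (φ-returns i ξ)))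
  , τ-strong
  where
    open TheoremNine 𝔯 Q R S ρ ρ-strong ρ₁-injective ρ₁-const q
    open Schemes.Construction 𝔯 Q R S ρ q using (τ)
    n₀ : ∀ i → Hom (Schemes.Rp 𝔯 i) (pos R) → ℕ
    n₀ i ξ = proj₁ (φ-returns i ξ)
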